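{- Let $G$ be a finite simple connected undirected graph on $V=\{1,\dots,n\}$ with $m$ edges, every vertex of degree at least $2$, and $G$ not a cycle. Then $Z^{(nb)}_v\mathbb 1=\mathbb 1$, $\pi^\top Z^{(nb)}_v=\pi^\top$, and $W_vZ^{(nb)}_v=W_v$.
   Context: $d_i=\deg(i)$, $D=\mathrm{diag}(d_1,\dots,d_n)$. Directed edges $\hat E$: the $2m$ ordered pairs $(i,j)$ with $\{i,j\}$ an edge. $P_{nb}$ is the $2m\times2m$ matrix with $P_{nb}((i,j),(k,\ell))=\frac1{d_j-1}$ if $j=k$, $\ell\neq i$, and $0$ otherwise. $S$ ($2m\times n$): $S((i,j),x)=1$ iff $j=x$; $T$ ($n\times 2m$): $T(x,(i,j))=1$ iff $i=x$. $\pi_i=d_i/(2m)$, $\pi_e=\frac1{2m}\mathbb 1\in\mathbb R^{2m}$, $W_v=\mathbb 1\pi^\top$, $W_e=\mathbb 1\pi_e^\top$. $Z^{(nb)}_e=(I-P_{nb}+W_e)^{ -1}$ and $Z^{(nb)}_v=D^{ -1}TZ^{(nb)}_eT^\top$ (which also equals $I+D^{ -1}TZ^{(nb)}_eS-W_v$). -}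

module Defs where

open import Data.Bool using (Bool; true; false; if_then_else_; not; _∧_)
open import Data.Nat as ℕ using (ℕ; zero; suc; _∸_; _≥_)
open import Data.Fin using (Fin; toℕ; _≟_)
open import Data.Integer using (+_)
open import Data.Rational using (ℚ; 0ℚ; 1ℚ; _+_; _*_; -_; _/_)
open import Data.Product using (Σ; _×_)
open import Data.Sum using (_⊎_)
open import Function using (Injective)
open import Relation.Binary.PropositionalEquality using (_≡_)
open import Relation.Nullary.Decidable using (⌊_⌋)

Adj : ℕ → Set
Adj n = Fin n → Fin n → Bool

IsSimple : ∀ {n} → Adj n → Set
IsSimple {n} A = (∀ (i j : Fin n) → A i j ≡ A j i) × (∀ (i : Fin n) → A i i ≡ false)

data Reachable {n} (A : Adj n) : Fin n → Fin n → Set where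
  here : ∀ {i} → Reachable A i i
  step : ∀ {i j k} → A i j ≡ true → Reachable A j k → Reachable A i k

IsConnected : ∀ {n} → Adj n → Set
IsConnected {n} A = ∀ (i j : Fin n) → Reachable A i j

-- adjacency in the standard cycle C_n on Fin n (i ~ i+1 mod n)
CycAdj : ∀ {n} → Fin n → Fin n → Set
CycAdj {n} a b =
  (suc (toℕ a) ≡ toℕ b) ⊎ (suc (toℕ b) ≡ toℕ a)
  ⊎ ((toℕ a ≡ 0) × (suc (toℕ b) ≡ n)) ⊎ ((toℕ b ≡ 0) × (suc (toℕ a) ≡ n))

IsCycle : ∀ {n} → Adj n → Set
IsCycle {n} A = (n ≥ 3) × Σ (Fin n → Fin n) λ f → Injective _≡_ _≡_ f ×
  (∀ (i j : Fin n) → (A i j ≡ true → CycAdj (f i) (f j)) × (CycAdj (f i) (f j) → A i j ≡ true))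

Σℚ : ∀ n → (Fin n → ℚ) → ℚ
Σℚ zero f = 0ℚ
Σℚ (suc n) f = f Data.Fin.zero + Σℚ n (λ i → f (Data.Fin.suc i))

Σℕ : ∀ n → (Fin n → ℕ) → ℕ
Σℕ zero f = 0
Σℕ (suc n) f = f Data.Fin.zero ℕ.+ Σℕ n (λ i → f (Data.Fin.suc i))

-- reciprocal of a natural number (1/0 := 0, never used under the hypotheses)
invℕ : ℕ → ℚ
invℕ zero = 0ℚ
invℕ (suc k) = + 1 / suc k

ofℕ : ℕ → ℚ
ofℕ k = + k / 1

_==_ : ∀ {n} → Fin n → Fin n → Bool
i == j = ⌊ i ≟ j ⌋

δ : ∀ {n} → Fin n → Fin n → ℚ
δ i j = if i == j then 1ℚ else 0ℚ

module Graph {n : ℕ} (A : Adj n) where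

  deg : Fin n → ℕ
  deg i = Σℕ n (λ j → if A i j then 1 else 0)

  twoM : ℕ
  twoM = Σℕ n deg

  π : Fin n → ℚ
  π i = ofℕ (deg i) * invℕ twoM

  -- Directed edges are the ordered pairs (i , j) with A i j ≡ true.
  -- A 2m×2m matrix indexed by directed edges is represented as a function
  -- of two pairs of vertices; only its entries at directed edges matter,
  -- since all sums below range over directed edges only.
  EMat : Set
  EMat = Fin n → Fin n → Fin n → Fin n → ℚ

  ΣE : (Fin n → Fin n → ℚ) → ℚ
  ΣE f = Σℚ n (λ i → Σℚ n (λ j → if A i j then f i j else 0ℚ))

  Pnb : EMat
  Pnb i j k l = if (j == k) ∧ not (l == i) then invℕ (deg j ∸ 1) else 0ℚ

  -- W_e = 1 π_eᵀ with π_e = (1/2m) 1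
  We : EMat
  We i j k l = invℕ twoM

  IE : EMat
  IE i j k l = δ i k * δ j l

  Mnb : EMat
  Mnb i j k l = IE i j k l + (- Pnb i j k l) + We i j k l

  _⊗_ : EMat → EMat → EMat
  (X ⊗ Y) i j k l = ΣE (λ a b → X i j a b * Y a b k l)

  _≈E_ : EMat → EMat → Set
  X ≈E Y = ∀ i j k l → A i j ≡ true → A k l ≡ true → X i j k l ≡ Y i j k l

  IsZe : EMat → Set
  IsZe Z = ((Mnb ⊗ Z) ≈E IE) × ((Z ⊗ Mnb) ≈E IE)

  -- Z_v = D⁻¹ T Z_e Tᵀ :  Z_v(x,y) = (1/d_x) Σ_{(x,j)∈Ê} Σ_{(y,l)∈Ê} Z_e((x,j),(y,l))
  Zv : EMat → Fin n → Fin n → ℚ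
  Zv Z x y = invℕ (deg x) *
    Σℚ n (λ j → Σℚ n (λ l → if A x j ∧ A y l then Z x j y l else 0ℚ))

  Wv : Fin n → Fin n → ℚ
  Wv x y = π y

  _⊙_ : (Fin n → Fin n → ℚ) → (Fin n → Fin n → ℚ) → Fin n → Fin n → ℚ
  (X ⊙ Y) x y = Σℚ n (λ z → X x z * Y z y)

-- Put M = I − P_nb + W_e. On directed edges every row of I, of P_nb and of W_e sums to 1
-- (the successors of (i, j) under P_nb are the d_j − 1 edges (j, ℓ) with ℓ ≠ i), so M 𝟙 = 𝟙;
-- and M is invariant under edge reversal, M((i,j),(k,ℓ)) = M((ℓ,k),(j,i)), so also 𝟙ᵀ M = 𝟙ᵀ.
-- Hence its inverse Z_e has unit row and column sums as well. Summing Z_v = D⁻¹ T Z_e Tᵀ over a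
-- row gives D⁻¹ T 𝟙 = 𝟙, and since πᵀ D⁻¹ = 𝟙ᵀ / 2m, πᵀ Z_v = 𝟙ᵀ Z_e Tᵀ / 2m = 𝟙ᵀ Tᵀ / 2m = πᵀ.
-- Finally W_v Z_v = 𝟙 (πᵀ Z_v) = W_v.

module Submission where

open import Defs
open import Algebra.Bundles using (Semiring; Ring)
import Algebra.Properties.Semiring.Sum as SemiringSum
open import Data.Bool using (Bool; true; false; if_then_else_; not; _∧_)
open import Data.Bool.Properties using (if-swap-then; if-∧)
open import Data.Fin using (Fin; zero; suc; _≟_)
import Data.Fin.Properties as Finₚ
open import Data.Integer using (+_; 1ℤ) renaming (_+_ to _+ℤ_; _*_ to _*ℤ_)
open import Data.Integer.Tactic.RingSolver using (solve-∀)
open import Data.Nat as ℕ using (ℕ; _≥_; _∸_; NonZero)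
import Data.Nat.Properties as ℕₚ
open import Data.Product using (_×_; _,_)
open import Data.Rational using (ℚ; 0ℚ; 1ℚ; _+_; _*_; -_; toℚᵘ)
import Data.Rational.Properties as ℚₚ
open import Data.Rational.Solver using (module +-*-Solver)
import Data.Rational.Unnormalised as ℚᵘ
import Data.Rational.Unnormalised.Properties as ℚᵘₚ
open import Data.Vec.Functional using (Vector)
open import Function using (_∘_; const; mk⇔)
open import Relation.Nullary using (¬_; yes; no)
open import Relation.Nullary.Decidable using (does; isYes; isYes≗does; does-⇔; ⌊⌋-map′)
open import Relation.Binary.PropositionalEquality
  using (_≡_; refl; sym; trans; cong; cong₂; subst; module ≡-Reasoning)

open import Algebra.Properties.Ring ℚₚ.+-*-ring using (-1*x≈-x)
open +-*-Solver using (solve; _:*_; _:=_; con)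

ℚ-semiring : Semiring _ _
ℚ-semiring = Ring.semiring ℚₚ.+-*-ring

toℚᵘ-ofℕ : ∀ k → toℚᵘ (ofℕ k) ℚᵘ.≃ ℚᵘ.mkℚᵘ (+ k) 0
toℚᵘ-ofℕ k = ℚₚ.toℚᵘ-fromℚᵘ (ℚᵘ.mkℚᵘ (+ k) 0)

ofℕ-+ : ∀ a b → ofℕ (a ℕ.+ b) ≡ ofℕ a + ofℕ b
ofℕ-+ a b = ℚₚ.toℚᵘ-injective (begin-equality
  toℚᵘ (ofℕ (a ℕ.+ b))                     ≃⟨ toℚᵘ-ofℕ (a ℕ.+ b) ⟩
  ℚᵘ.mkℚᵘ (+ a +ℤ + b) 0                   ≃⟨ ℚᵘ.*≡* (cross-multiplied (+ a) (+ b)) ⟩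
  ℚᵘ.mkℚᵘ (+ a) 0 ℚᵘ.+ ℚᵘ.mkℚᵘ (+ b) 0     ≃⟨ ℚᵘₚ.+-cong (toℚᵘ-ofℕ a) (toℚᵘ-ofℕ b) ⟨
  toℚᵘ (ofℕ a) ℚᵘ.+ toℚᵘ (ofℕ b)           ≃⟨ ℚₚ.toℚᵘ-homo-+ (ofℕ a) (ofℕ b) ⟨
  toℚᵘ (ofℕ a + ofℕ b)                     ∎)
  where
  open ℚᵘₚ.≤-Reasoning
  cross-multiplied : ∀ x y → (x +ℤ y) *ℤ 1ℤ ≡ (x *ℤ 1ℤ +ℤ y *ℤ 1ℤ) *ℤ 1ℤ
  cross-multiplied = solve-∀

-- invℕ m reduces to fromℚᵘ (ℚᵘ.1/ mkℚᵘ (+ m) 0), which is what toℚᵘ-fromℚᵘ is applied to below.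
ofℕ*invℕ : ∀ m .{{_ : NonZero m}} → ofℕ m * invℕ m ≡ 1ℚ
ofℕ*invℕ m@(ℕ.suc k) = ℚₚ.toℚᵘ-injective (begin-equality
  toℚᵘ (ofℕ m * invℕ m)             ≃⟨ ℚₚ.toℚᵘ-homo-* (ofℕ m) (invℕ m) ⟩
  toℚᵘ (ofℕ m) ℚᵘ.* toℚᵘ (invℕ m)   ≃⟨ ℚᵘₚ.*-cong (toℚᵘ-ofℕ m) (ℚₚ.toℚᵘ-fromℚᵘ (ℚᵘ.1/ p)) ⟩
  p ℚᵘ.* ℚᵘ.1/ p                    ≃⟨ ℚᵘₚ.*-inverseʳ p ⟩
  ℚᵘ.1ℚᵘ                            ∎)
  where
  open ℚᵘₚ.≤-Reasoning
  p : ℚᵘ.ℚᵘ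
  p = ℚᵘ.mkℚᵘ (+ m) 0

ofℕ-Σℕ : ∀ n (f : Fin n → ℕ) → ofℕ (Σℕ n f) ≡ Σℚ n (ofℕ ∘ f)
ofℕ-Σℕ ℕ.zero    f = refl
ofℕ-Σℕ (ℕ.suc n) f = trans (ofℕ-+ (f zero) _) (cong (λ s → ofℕ (f zero) + s) (ofℕ-Σℕ n (f ∘ suc)))

==-sym : ∀ {n} (i j : Fin n) → (i == j) ≡ (j == i)
==-sym i j = begin
  isYes (i ≟ j)  ≡⟨ isYes≗does (i ≟ j) ⟩
  does (i ≟ j)   ≡⟨ does-⇔ (mk⇔ sym sym) (i ≟ j) (j ≟ i) ⟩
  does (j ≟ i)   ≡⟨ isYes≗does (j ≟ i) ⟨
  isYes (j ≟ i)  ∎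
  where open ≡-Reasoning

==-suc : ∀ {n} (i j : Fin n) → (suc i == suc j) ≡ (i == j)
==-suc i j = ⌊⌋-map′ (cong suc) Finₚ.suc-injective (i ≟ j)

module _ {c ℓ} (R : Semiring c ℓ) where
  open Semiring R using (Carrier; _≈_; 0#; +-congˡ; +-identityˡ; +-identityʳ)
    renaming (trans to ≈-trans; reflexive to ≈-reflexive)
  open SemiringSum R using (sum; sum-cong-≗; sum-replicate-zero)

  sum-δ : ∀ {n} (i : Fin n) (f : Vector Carrier n) → sum (λ k → if i == k then f k else 0#) ≈ f i
  sum-δ {ℕ.suc n} zero    f = ≈-trans (+-congˡ (sum-replicate-zero n)) (+-identityʳ (f zero))
  sum-δ {ℕ.suc n} (suc i) f =
    ≈-trans (+-identityˡ _) (≈-trans (≈-reflexive (sum-cong-≗ tail-δ)) (sum-δ i (f ∘ suc)))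
    where
    tail-δ : ∀ k → (if suc i == suc k then f (suc k) else 0#) ≡ (if i == k then f (suc k) else 0#)
    tail-δ k = cong (if_then f (suc k) else 0#) (==-suc i k)

open SemiringSum ℚ-semiring
  using (sum; sum-cong-≗; ∑-comm; ∑-distrib-+; *-distribˡ-sum; *-distribʳ-sum; sum-replicate-zero)

Σℚ≡sum : ∀ n (f : Fin n → ℚ) → Σℚ n f ≡ sum f
Σℚ≡sum ℕ.zero    f = refl
Σℚ≡sum (ℕ.suc n) f = cong (λ s → f zero + s) (Σℚ≡sum n (f ∘ suc))

Σℚ-cong : ∀ {n} {f g : Fin n → ℚ} → (∀ i → f i ≡ g i) → Σℚ n f ≡ Σℚ n g
Σℚ-cong {n} {f} {g} f≗g = begin
  Σℚ n f  ≡⟨ Σℚ≡sum n f ⟩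
  sum f   ≡⟨ sum-cong-≗ f≗g ⟩
  sum g   ≡⟨ Σℚ≡sum n g ⟨
  Σℚ n g  ∎
  where open ≡-Reasoning

Σℚ-zero : ∀ n → Σℚ n (λ _ → 0ℚ) ≡ 0ℚ
Σℚ-zero n = trans (Σℚ≡sum n _) (sum-replicate-zero n)

Σℚ-distrib-+ : ∀ n (f g : Fin n → ℚ) → Σℚ n (λ i → f i + g i) ≡ Σℚ n f + Σℚ n g
Σℚ-distrib-+ n f g = begin
  Σℚ n (λ i → f i + g i)  ≡⟨ Σℚ≡sum n _ ⟩
  sum (λ i → f i + g i)   ≡⟨ ∑-distrib-+ f g ⟩
  sum f + sum g           ≡⟨ cong₂ _+_ (Σℚ≡sum n f) (Σℚ≡sum n g) ⟨
  Σℚ n f + Σℚ n g         ∎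
  where open ≡-Reasoning

*-distribˡ-Σℚ : ∀ n c (f : Fin n → ℚ) → c * Σℚ n f ≡ Σℚ n (λ i → c * f i)
*-distribˡ-Σℚ n c f = begin
  c * Σℚ n f             ≡⟨ cong (c *_) (Σℚ≡sum n f) ⟩
  c * sum f              ≡⟨ *-distribˡ-sum c f ⟩
  sum (λ i → c * f i)    ≡⟨ Σℚ≡sum n _ ⟨
  Σℚ n (λ i → c * f i)   ∎
  where open ≡-Reasoning

*-distribʳ-Σℚ : ∀ n c (f : Fin n → ℚ) → Σℚ n f * c ≡ Σℚ n (λ i → f i * c)
*-distribʳ-Σℚ n c f = begin
  Σℚ n f * c             ≡⟨ cong (_* c) (Σℚ≡sum n f) ⟩
  sum f * c              ≡⟨ *-distribʳ-sum c f ⟩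
  sum (λ i → f i * c)    ≡⟨ Σℚ≡sum n _ ⟨
  Σℚ n (λ i → f i * c)   ∎
  where open ≡-Reasoning

Σℚ-comm : ∀ m n (f : Fin m → Fin n → ℚ) →
          Σℚ m (λ i → Σℚ n (f i)) ≡ Σℚ n (λ j → Σℚ m (λ i → f i j))
Σℚ-comm m n f = begin
  Σℚ m (λ i → Σℚ n (f i))             ≡⟨ Σℚ-cong (λ i → Σℚ≡sum n (f i)) ⟩
  Σℚ m (λ i → sum (f i))              ≡⟨ Σℚ≡sum m _ ⟩
  sum (λ i → sum (f i))               ≡⟨ ∑-comm f ⟩
  sum (λ j → sum (λ i → f i j))       ≡⟨ Σℚ≡sum n _ ⟨
  Σℚ n (λ j → sum (λ i → f i j))      ≡⟨ Σℚ-cong (λ j → Σℚ≡sum m (λ i → f i j)) ⟨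
  Σℚ n (λ j → Σℚ m (λ i → f i j))     ∎
  where open ≡-Reasoning

Σℚ-δ : ∀ {n} (i : Fin n) (f : Fin n → ℚ) → Σℚ n (λ k → if i == k then f k else 0ℚ) ≡ f i
Σℚ-δ {n} i f = trans (Σℚ≡sum n _) (sum-δ (ℚ-semiring) i f)

count : ∀ {n} → (Fin n → Bool) → ℕ
count {n} p = Σℕ n (λ i → if p i then 1 else 0)

count-cong : ∀ {n} {p q : Fin n → Bool} → (∀ i → p i ≡ q i) → count p ≡ count q
count-cong {ℕ.zero}  p≗q = refl
count-cong {ℕ.suc n} p≗q =
  cong₂ (λ b m → (if b then 1 else 0) ℕ.+ m) (p≗q zero) (count-cong (p≗q ∘ suc))

count-without : ∀ {n} (p : Fin n → Bool) a → p a ≡ true →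
                count p ≡ ℕ.suc (count (λ l → not (l == a) ∧ p l))
count-without {ℕ.suc n} p zero    pa rewrite pa = refl
count-without {ℕ.suc n} p (suc a) pa = begin
  p₀ ℕ.+ count (p ∘ suc)
    ≡⟨ cong (p₀ ℕ.+_) (count-without (p ∘ suc) a pa) ⟩
  p₀ ℕ.+ ℕ.suc (count (λ l → not (l == a) ∧ p (suc l)))
    ≡⟨ ℕₚ.+-suc p₀ _ ⟩
  ℕ.suc (p₀ ℕ.+ count (λ l → not (l == a) ∧ p (suc l)))
    ≡⟨ cong (λ m → ℕ.suc (p₀ ℕ.+ m)) (count-cong shift) ⟨
  ℕ.suc (count (λ l → not (l == suc a) ∧ p l)) ∎
  where
  open ≡-Reasoning
  p₀ : ℕ
  p₀ = if p zero then 1 else 0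
  shift : ∀ l → (not (suc l == suc a) ∧ p (suc l)) ≡ (not (l == a) ∧ p (suc l))
  shift l = cong (λ b → not b ∧ p (suc l)) (==-suc l a)

if-Σℚ : ∀ b n (f : Fin n → ℚ) → (if b then Σℚ n f else 0ℚ) ≡ Σℚ n (λ i → if b then f i else 0ℚ)
if-Σℚ true  n f = refl
if-Σℚ false n f = sym (Σℚ-zero n)

-- Σℚ n f is definitionally Σ⟨ const true ⟩ f, and ΣE f is Σℚ n (λ i → Σ⟨ A i ⟩ (f i)).
Σ⟨_⟩ : ∀ {n} → (Fin n → Bool) → (Fin n → ℚ) → ℚ
Σ⟨_⟩ {n} p f = Σℚ n (λ i → if p i then f i else 0ℚ)

Σ⟨⟩-const : ∀ {n} (p : Fin n → Bool) c → Σ⟨ p ⟩ (λ _ → c) ≡ ofℕ (count p) * c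
Σ⟨⟩-const {n} p c = begin
  Σℚ n (λ i → if p i then c else 0ℚ)            ≡⟨ Σℚ-cong (λ i → indicator (p i)) ⟩
  Σℚ n (λ i → ofℕ (if p i then 1 else 0) * c)   ≡⟨ *-distribʳ-Σℚ n c _ ⟨
  Σℚ n (λ i → ofℕ (if p i then 1 else 0)) * c   ≡⟨ cong (_* c) (ofℕ-Σℕ n _) ⟨
  ofℕ (count p) * c                             ∎
  where
  open ≡-Reasoning
  indicator : ∀ b → (if b then c else 0ℚ) ≡ ofℕ (if b then 1 else 0) * c
  indicator true  = sym (ℚₚ.*-identityˡ c)
  indicator false = sym (ℚₚ.*-zeroˡ c)

Σ⟨⟩-cong : ∀ {n} (p : Fin n → Bool) {f g : Fin n → ℚ} →
           (∀ i → p i ≡ true → f i ≡ g i) → Σ⟨ p ⟩ f ≡ Σ⟨ p ⟩ g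
Σ⟨⟩-cong p f≗g = Σℚ-cong (λ i → masked (p i) (f≗g i))
  where
  masked : ∀ b {x y} → (b ≡ true → x ≡ y) → (if b then x else 0ℚ) ≡ (if b then y else 0ℚ)
  masked true  x≡y = x≡y refl
  masked false _   = refl

Σ⟨⟩-distrib-+ : ∀ {n} (p : Fin n → Bool) (f g : Fin n → ℚ) →
                Σ⟨ p ⟩ (λ i → f i + g i) ≡ Σ⟨ p ⟩ f + Σ⟨ p ⟩ g
Σ⟨⟩-distrib-+ {n} p f g = trans (Σℚ-cong (λ i → masked (p i))) (Σℚ-distrib-+ n _ _)
  where
  masked : ∀ b {x y} → (if b then x + y else 0ℚ) ≡ (if b then x else 0ℚ) + (if b then y else 0ℚ)
  masked true  = refl
  masked false = refl

*-distribˡ-Σ⟨⟩ : ∀ {n} (p : Fin n → Bool) c (f : Fin n → ℚ) →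
                 c * Σ⟨ p ⟩ f ≡ Σ⟨ p ⟩ (λ i → c * f i)
*-distribˡ-Σ⟨⟩ {n} p c f = trans (*-distribˡ-Σℚ n c _) (Σℚ-cong (λ i → masked (p i)))
  where
  masked : ∀ b {x} → c * (if b then x else 0ℚ) ≡ (if b then c * x else 0ℚ)
  masked true  = refl
  masked false = ℚₚ.*-zeroʳ c

*-distribʳ-Σ⟨⟩ : ∀ {n} (p : Fin n → Bool) c (f : Fin n → ℚ) →
                 Σ⟨ p ⟩ f * c ≡ Σ⟨ p ⟩ (λ i → f i * c)
*-distribʳ-Σ⟨⟩ {n} p c f = trans (*-distribʳ-Σℚ n c _) (Σℚ-cong (λ i → masked (p i)))
  where
  masked : ∀ b {x} → (if b then x else 0ℚ) * c ≡ (if b then x * c else 0ℚ)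
  masked true  = refl
  masked false = ℚₚ.*-zeroˡ c

Σ⟨⟩-comm : ∀ {m n} (p : Fin m → Bool) (q : Fin n → Bool) (f : Fin m → Fin n → ℚ) →
           Σ⟨ p ⟩ (λ i → Σ⟨ q ⟩ (f i)) ≡ Σ⟨ q ⟩ (λ j → Σ⟨ p ⟩ (λ i → f i j))
Σ⟨⟩-comm {m} {n} p q f = begin
  Σℚ m (λ i → if p i then Σℚ n (λ j → if q j then f i j else 0ℚ) else 0ℚ)
    ≡⟨ Σℚ-cong (λ i → if-Σℚ (p i) n _) ⟩
  Σℚ m (λ i → Σℚ n (λ j → if p i then (if q j then f i j else 0ℚ) else 0ℚ))
    ≡⟨ Σℚ-comm m n _ ⟩
  Σℚ n (λ j → Σℚ m (λ i → if p i then (if q j then f i j else 0ℚ) else 0ℚ))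
    ≡⟨ Σℚ-cong (λ j → Σℚ-cong (λ i → if-swap-then (p i) (q j))) ⟩
  Σℚ n (λ j → Σℚ m (λ i → if q j then (if p i then f i j else 0ℚ) else 0ℚ))
    ≡⟨ Σℚ-cong (λ j → if-Σℚ (q j) m _) ⟨
  Σℚ n (λ j → if q j then Σℚ m (λ i → if p i then f i j else 0ℚ) else 0ℚ) ∎
  where open ≡-Reasoning

f≤Σℕ : ∀ n (f : Fin n → ℕ) i → f i ℕ.≤ Σℕ n f
f≤Σℕ (ℕ.suc n) f zero    = ℕₚ.m≤m+n (f zero) _
f≤Σℕ (ℕ.suc n) f (suc i) = ℕₚ.≤-trans (f≤Σℕ n (f ∘ suc) i) (ℕₚ.m≤n+m _ (f zero))

δ-sym : ∀ {n} (i j : Fin n) → δ i j ≡ δ j i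
δ-sym i j = cong (if_then 1ℚ else 0ℚ) (==-sym i j)

δ-* : ∀ {n} (i j : Fin n) x → δ i j * x ≡ (if i == j then x else 0ℚ)
δ-* i j x with i == j
... | true  = ℚₚ.*-identityˡ x
... | false = ℚₚ.*-zeroˡ x

module _ {n} (A : Adj n) where
  open Graph A

  rowSum colSum : EMat → Fin n → Fin n → ℚ
  rowSum X i j = ΣE (X i j)
  colSum X k l = ΣE (λ i j → X i j k l)

  UnitRowSums UnitColSums : EMat → Set
  UnitRowSums X = ∀ i j → A i j ≡ true → rowSum X i j ≡ 1ℚ
  UnitColSums X = ∀ k l → A k l ≡ true → colSum X k l ≡ 1ℚ

  ΣE-cong : ∀ {f g : Fin n → Fin n → ℚ} → (∀ i j → A i j ≡ true → f i j ≡ g i j) → ΣE f ≡ ΣE g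
  ΣE-cong f≗g = Σℚ-cong (λ i → Σ⟨⟩-cong (A i) (f≗g i))

  ΣE-distrib-+ : ∀ (f g : Fin n → Fin n → ℚ) → ΣE (λ i j → f i j + g i j) ≡ ΣE f + ΣE g
  ΣE-distrib-+ f g = trans (Σℚ-cong (λ i → Σ⟨⟩-distrib-+ (A i) (f i) (g i))) (Σℚ-distrib-+ n _ _)

  *-distribˡ-ΣE : ∀ c (f : Fin n → Fin n → ℚ) → c * ΣE f ≡ ΣE (λ i j → c * f i j)
  *-distribˡ-ΣE c f = trans (*-distribˡ-Σℚ n c _) (Σℚ-cong (λ i → *-distribˡ-Σ⟨⟩ (A i) c (f i)))

  *-distribʳ-ΣE : ∀ c (f : Fin n → Fin n → ℚ) → ΣE f * c ≡ ΣE (λ i j → f i j * c)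
  *-distribʳ-ΣE c f = trans (*-distribʳ-Σℚ n c _) (Σℚ-cong (λ i → *-distribʳ-Σ⟨⟩ (A i) c (f i)))

  ΣE-const : ∀ c → ΣE (λ _ _ → c) ≡ ofℕ twoM * c
  ΣE-const c = begin
    Σℚ n (λ i → Σ⟨ A i ⟩ (λ _ → c))   ≡⟨ Σℚ-cong (λ i → Σ⟨⟩-const (A i) c) ⟩
    Σℚ n (λ i → ofℕ (deg i) * c)      ≡⟨ *-distribʳ-Σℚ n c _ ⟨
    Σℚ n (λ i → ofℕ (deg i)) * c      ≡⟨ cong (_* c) (ofℕ-Σℕ n deg) ⟨
    ofℕ twoM * c                      ∎
    where open ≡-Reasoning

  ΣE-Σ⟨⟩-comm : ∀ {m} (q : Fin m → Bool) (F : Fin n → Fin n → Fin m → ℚ) →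
                ΣE (λ i j → Σ⟨ q ⟩ (F i j)) ≡ Σ⟨ q ⟩ (λ y → ΣE (λ i j → F i j y))
  ΣE-Σ⟨⟩-comm q F = trans (Σℚ-cong (λ i → Σ⟨⟩-comm (A i) q (F i)))
                          (Σ⟨⟩-comm (const true) q (λ i y → Σ⟨ A i ⟩ (λ j → F i j y)))

  ΣE-comm : ∀ (F : Fin n → Fin n → Fin n → Fin n → ℚ) →
            ΣE (λ k l → ΣE (λ a b → F a b k l)) ≡ ΣE (λ a b → ΣE (λ k l → F a b k l))
  ΣE-comm F = trans (ΣE-Σ⟨⟩-comm (const true) (λ k l a → Σ⟨ A a ⟩ (λ b → F a b k l)))
                    (Σℚ-cong (λ a → ΣE-Σ⟨⟩-comm (A a) (λ k l b → F a b k l)))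

  ΣE-δ : ∀ a (g : Fin n → Fin n → ℚ) → ΣE (λ k l → if a == k then g k l else 0ℚ) ≡ Σ⟨ A a ⟩ (g a)
  ΣE-δ a g = trans (Σℚ-cong (λ k → Σ⟨⟩-if (a == k) (A k) (g k))) (Σℚ-δ a (λ k → Σ⟨ A k ⟩ (g k)))
    where
    Σ⟨⟩-if : ∀ b p (f : Fin n → ℚ) → Σ⟨ p ⟩ (λ l → if b then f l else 0ℚ) ≡ (if b then Σ⟨ p ⟩ f else 0ℚ)
    Σ⟨⟩-if b p f = trans (Σℚ-cong (λ l → if-swap-then (p l) b)) (sym (if-Σℚ b n _))

  rowSum-⊗ : ∀ X Y i j → rowSum (X ⊗ Y) i j ≡ ΣE (λ a b → X i j a b * rowSum Y a b)
  rowSum-⊗ X Y i j =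
    trans (ΣE-comm _) (ΣE-cong (λ a b _ → sym (*-distribˡ-ΣE (X i j a b) (Y a b))))

  colSum-⊗ : ∀ X Y k l → colSum (X ⊗ Y) k l ≡ ΣE (λ a b → colSum X a b * Y a b k l)
  colSum-⊗ X Y k l =
    trans (ΣE-comm _) (ΣE-cong (λ a b _ → sym (*-distribʳ-ΣE (Y a b k l) (λ i j → X i j a b))))

  IE-unitRowSums : UnitRowSums IE
  IE-unitRowSums a b ab = begin
    ΣE (λ k l → δ a k * δ b l)
      ≡⟨ ΣE-cong (λ k l _ → δ-* a k (δ b l)) ⟩
    ΣE (λ k l → if a == k then δ b l else 0ℚ)
      ≡⟨ ΣE-δ a (λ _ → δ b) ⟩
    Σ⟨ A a ⟩ (δ b)
      ≡⟨ Σℚ-cong (λ l → if-swap-then (A a l) (b == l)) ⟩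
    Σℚ n (λ l → if b == l then (if A a l then 1ℚ else 0ℚ) else 0ℚ)
      ≡⟨ Σℚ-δ b _ ⟩
    (if A a b then 1ℚ else 0ℚ)
      ≡⟨ cong (if_then 1ℚ else 0ℚ) ab ⟩
    1ℚ ∎
    where open ≡-Reasoning

  IE-unitColSums : UnitColSums IE
  IE-unitColSums k l kl =
    trans (ΣE-cong (λ i j _ → cong₂ _*_ (δ-sym i k) (δ-sym j l))) (IE-unitRowSums k l kl)

  ⊗≈IE⇒unitRowSums : ∀ {X Y} → (X ⊗ Y) ≈E IE → UnitRowSums Y → UnitRowSums X
  ⊗≈IE⇒unitRowSums {X} {Y} XY≈I Y-rows i j ij = begin
    rowSum X i j
      ≡⟨ ΣE-cong (λ a b _ → ℚₚ.*-identityʳ (X i j a b)) ⟨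
    ΣE (λ a b → X i j a b * 1ℚ)
      ≡⟨ ΣE-cong (λ a b ab → cong (X i j a b *_) (Y-rows a b ab)) ⟨
    ΣE (λ a b → X i j a b * rowSum Y a b)
      ≡⟨ rowSum-⊗ X Y i j ⟨
    rowSum (X ⊗ Y) i j
      ≡⟨ ΣE-cong (λ k l kl → XY≈I i j k l ij kl) ⟩
    rowSum IE i j
      ≡⟨ IE-unitRowSums i j ij ⟩
    1ℚ ∎
    where open ≡-Reasoning

  ⊗≈IE⇒unitColSums : ∀ {X Y} → (X ⊗ Y) ≈E IE → UnitColSums X → UnitColSums Y
  ⊗≈IE⇒unitColSums {X} {Y} XY≈I X-cols k l kl = begin
    colSum Y k l
      ≡⟨ ΣE-cong (λ a b _ → ℚₚ.*-identityˡ (Y a b k l)) ⟨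
    ΣE (λ a b → 1ℚ * Y a b k l)
      ≡⟨ ΣE-cong (λ a b ab → cong (_* Y a b k l) (X-cols a b ab)) ⟨
    ΣE (λ a b → colSum X a b * Y a b k l)
      ≡⟨ colSum-⊗ X Y k l ⟨
    colSum (X ⊗ Y) k l
      ≡⟨ ΣE-cong (λ i j ij → XY≈I i j k l ij kl) ⟩
    colSum IE k l
      ≡⟨ IE-unitColSums k l kl ⟩
    1ℚ ∎
    where open ≡-Reasoning

  Zv-Σ⟨⟩ : ∀ Z x y → Zv Z x y ≡ invℕ (deg x) * Σ⟨ A x ⟩ (λ j → Σ⟨ A y ⟩ (Z x j y))
  Zv-Σ⟨⟩ Z x y = cong (invℕ (deg x) *_) (Σℚ-cong (λ j →
    trans (Σℚ-cong {n} (λ l → if-∧ (A x j) {A y l} {Z x j y l} {0ℚ}))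
          (sym (if-Σℚ (A x j) n (λ l → if A y l then Z x j y l else 0ℚ)))))

  Zv-rowSum : ∀ {Z} → UnitRowSums Z → ∀ x .{{_ : NonZero (deg x)}} → Σℚ n (Zv Z x) ≡ 1ℚ
  Zv-rowSum {Z} Z-rows x = begin
    Σℚ n (Zv Z x)
      ≡⟨ Σℚ-cong (Zv-Σ⟨⟩ Z x) ⟩
    Σℚ n (λ y → d⁻¹ * Σ⟨ A x ⟩ (λ j → Σ⟨ A y ⟩ (Z x j y)))
      ≡⟨ *-distribˡ-Σℚ n d⁻¹ _ ⟨
    d⁻¹ * Σℚ n (λ y → Σ⟨ A x ⟩ (λ j → Σ⟨ A y ⟩ (Z x j y)))
      ≡⟨ cong (d⁻¹ *_) (Σ⟨⟩-comm (const true) (A x) (λ y j → Σ⟨ A y ⟩ (Z x j y))) ⟩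
    d⁻¹ * Σ⟨ A x ⟩ (rowSum Z x)
      ≡⟨ cong (d⁻¹ *_) (Σ⟨⟩-cong (A x) (Z-rows x)) ⟩
    d⁻¹ * Σ⟨ A x ⟩ (λ _ → 1ℚ)
      ≡⟨ cong (d⁻¹ *_) (Σ⟨⟩-const (A x) 1ℚ) ⟩
    d⁻¹ * (ofℕ (deg x) * 1ℚ)
      ≡⟨ solve 2 (λ a b → b :* (a :* con 1ℚ) := a :* b) refl (ofℕ (deg x)) d⁻¹ ⟩
    ofℕ (deg x) * d⁻¹
      ≡⟨ ofℕ*invℕ (deg x) ⟩
    1ℚ ∎
    where
    open ≡-Reasoning
    d⁻¹ : ℚ
    d⁻¹ = invℕ (deg x)

  π*Zv : ∀ Z x y .{{_ : NonZero (deg x)}} →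
         π x * Zv Z x y ≡ invℕ twoM * Σ⟨ A x ⟩ (λ j → Σ⟨ A y ⟩ (Z x j y))
  π*Zv Z x y = begin
    π x * Zv Z x y
      ≡⟨ cong (π x *_) (Zv-Σ⟨⟩ Z x y) ⟩
    (ofℕ (deg x) * m⁻¹) * (d⁻¹ * S)
      ≡⟨ solve 4 (λ a b c s → (a :* b) :* (c :* s) := b :* ((a :* c) :* s))
                 refl (ofℕ (deg x)) m⁻¹ d⁻¹ S ⟩
    m⁻¹ * ((ofℕ (deg x) * d⁻¹) * S)
      ≡⟨ cong (λ r → m⁻¹ * (r * S)) (ofℕ*invℕ (deg x)) ⟩
    m⁻¹ * (1ℚ * S)
      ≡⟨ cong (m⁻¹ *_) (ℚₚ.*-identityˡ S) ⟩
    m⁻¹ * S ∎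
    where
    open ≡-Reasoning
    m⁻¹ : ℚ
    m⁻¹ = invℕ twoM
    d⁻¹ : ℚ
    d⁻¹ = invℕ (deg x)
    S : ℚ
    S = Σ⟨ A x ⟩ (λ j → Σ⟨ A y ⟩ (Z x j y))

  π-Zv-colSum : ∀ {Z} → UnitColSums Z → (∀ x → NonZero (deg x)) →
                ∀ y → Σℚ n (λ x → π x * Zv Z x y) ≡ π y
  π-Zv-colSum {Z} Z-cols deg≢0 y = begin
    Σℚ n (λ x → π x * Zv Z x y)
      ≡⟨ Σℚ-cong (λ x → π*Zv Z x y {{deg≢0 x}}) ⟩
    Σℚ n (λ x → m⁻¹ * Σ⟨ A x ⟩ (λ j → Σ⟨ A y ⟩ (Z x j y)))
      ≡⟨ *-distribˡ-Σℚ n m⁻¹ _ ⟨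
    m⁻¹ * ΣE (λ x j → Σ⟨ A y ⟩ (Z x j y))
      ≡⟨ cong (m⁻¹ *_) (ΣE-Σ⟨⟩-comm (A y) (λ x j → Z x j y)) ⟩
    m⁻¹ * Σ⟨ A y ⟩ (colSum Z y)
      ≡⟨ cong (m⁻¹ *_) (Σ⟨⟩-cong (A y) (Z-cols y)) ⟩
    m⁻¹ * Σ⟨ A y ⟩ (λ _ → 1ℚ)
      ≡⟨ cong (m⁻¹ *_) (Σ⟨⟩-const (A y) 1ℚ) ⟩
    m⁻¹ * (ofℕ (deg y) * 1ℚ)
      ≡⟨ solve 2 (λ a b → b :* (a :* con 1ℚ) := a :* b) refl (ofℕ (deg y)) m⁻¹ ⟩
    π y ∎
    where
    open ≡-Reasoning
    m⁻¹ : ℚ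
    m⁻¹ = invℕ twoM

  Reversible : EMat → Set
  Reversible X = ∀ i j k l → X i j k l ≡ X l k j i

  IE-reversible : Reversible IE
  IE-reversible i j k l = trans (ℚₚ.*-comm (δ i k) (δ j l)) (cong₂ _*_ (δ-sym j l) (δ-sym i k))

  Pnb-reversible : Reversible Pnb
  Pnb-reversible i j k l rewrite ==-sym k j | ==-sym i l with j ≟ k
  ... | yes refl = refl
  ... | no  _    = refl

  Mnb-reversible : Reversible Mnb
  Mnb-reversible i j k l =
    cong₂ (λ e p → e + - p + invℕ twoM) (IE-reversible i j k l) (Pnb-reversible i j k l)

  module _ (A-sym : ∀ i j → A i j ≡ A j i) where

    ΣE-reverse : ∀ (f : Fin n → Fin n → ℚ) → ΣE f ≡ ΣE (λ i j → f j i)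
    ΣE-reverse f = trans (Σℚ-comm n n _) (Σℚ-cong (λ j → Σℚ-cong (λ i →
      cong (if_then f i j else 0ℚ) (A-sym i j))))

    reversible⇒unitColSums : ∀ {X} → Reversible X → UnitRowSums X → UnitColSums X
    reversible⇒unitColSums {X} X-rev X-rows k l kl = begin
      ΣE (λ i j → X i j k l)   ≡⟨ ΣE-cong (λ i j _ → X-rev i j k l) ⟩
      ΣE (λ i j → X l k j i)   ≡⟨ ΣE-reverse (X l k) ⟨
      rowSum X l k             ≡⟨ X-rows l k (trans (A-sym l k) kl) ⟩
      1ℚ                       ∎
      where open ≡-Reasoning

    module _ (deg≥2 : ∀ x → deg x ≥ 2) where

      Pnb-unitRowSums : UnitRowSums Pnb
      Pnb-unitRowSums a b ab = begin
        ΣE (λ k l → if (b == k) ∧ not (l == a) then c else 0ℚ)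
          ≡⟨ ΣE-cong (λ k l _ → if-∧ (b == k)) ⟩
        ΣE (λ k l → if b == k then (if not (l == a) then c else 0ℚ) else 0ℚ)
          ≡⟨ ΣE-δ b (λ _ l → if not (l == a) then c else 0ℚ) ⟩
        Σ⟨ A b ⟩ (λ l → if not (l == a) then c else 0ℚ)
          ≡⟨ Σℚ-cong (λ l → trans (if-swap-then (A b l) (not (l == a)))
                                  (sym (if-∧ (not (l == a))))) ⟩
        Σ⟨ (λ l → not (l == a) ∧ A b l) ⟩ (λ _ → c)
          ≡⟨ Σ⟨⟩-const (λ l → not (l == a) ∧ A b l) c ⟩
        ofℕ others * invℕ (deg b ∸ 1)
          ≡⟨ cong (λ d → ofℕ others * invℕ (d ∸ 1)) deg-b ⟩
        ofℕ others * invℕ others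
          ≡⟨ ofℕ*invℕ others {{ℕ.>-nonZero (ℕₚ.≤-pred (subst (2 ℕ.≤_) deg-b (deg≥2 b)))}} ⟩
        1ℚ ∎
        where
        open ≡-Reasoning
        c : ℚ
        c = invℕ (deg b ∸ 1)
        others : ℕ
        others = count (λ l → not (l == a) ∧ A b l)
        deg-b : deg b ≡ ℕ.suc others
        deg-b = count-without (A b) a (trans (A-sym b a) ab)

      twoM≢0 : Fin n → NonZero twoM
      twoM≢0 x = ℕ.>-nonZero (ℕₚ.≤-trans (ℕₚ.≤-trans (ℕ.s≤s ℕ.z≤n) (deg≥2 x)) (f≤Σℕ n deg x))

      We-unitRowSums : UnitRowSums We
      We-unitRowSums a b _ = trans (ΣE-const (invℕ twoM)) (ofℕ*invℕ twoM {{twoM≢0 a}})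

      Mnb-unitRowSums : UnitRowSums Mnb
      Mnb-unitRowSums a b ab = begin
        ΣE (λ k l → IE a b k l + - Pnb a b k l + We a b k l)
          ≡⟨ ΣE-cong (λ k l _ → cong (λ p → IE a b k l + p + We a b k l)
                                     (sym (-1*x≈-x (Pnb a b k l)))) ⟩
        ΣE (λ k l → IE a b k l + - 1ℚ * Pnb a b k l + We a b k l)
          ≡⟨ ΣE-distrib-+ _ (We a b) ⟩
        ΣE (λ k l → IE a b k l + - 1ℚ * Pnb a b k l) + rowSum We a b
          ≡⟨ cong (_+ rowSum We a b) (ΣE-distrib-+ (IE a b) _) ⟩
        rowSum IE a b + ΣE (λ k l → - 1ℚ * Pnb a b k l) + rowSum We a b
          ≡⟨ cong (λ p → rowSum IE a b + p + rowSum We a b) (*-distribˡ-ΣE (- 1ℚ) (Pnb a b)) ⟨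
        rowSum IE a b + - 1ℚ * rowSum Pnb a b + rowSum We a b
          ≡⟨ cong₂ (λ e p → e + - 1ℚ * p + rowSum We a b)
                   (IE-unitRowSums a b ab) (Pnb-unitRowSums a b ab) ⟩
        1ℚ + - 1ℚ * 1ℚ + rowSum We a b
          ≡⟨ cong (λ w → 1ℚ + - 1ℚ * 1ℚ + w) (We-unitRowSums a b ab) ⟩
        1ℚ + - 1ℚ * 1ℚ + 1ℚ
          ≡⟨⟩
        1ℚ ∎
        where open ≡-Reasoning

-- Connectivity and not being a cycle are what make I − P_nb + W_e invertible; here the inverse
-- Ze is part of the hypotheses.
mainTheorem3 : (n : ℕ) (A : Adj n) → IsSimple A → IsConnected A
    → (∀ (i : Fin n) → Graph.deg A i ≥ 2) → ¬ IsCycle A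
    → (Ze : Graph.EMat A) → Graph.IsZe A Ze
    → (∀ (x : Fin n) → Σℚ n (λ y → Graph.Zv A Ze x y) ≡ 1ℚ)
      × (∀ (y : Fin n) → Σℚ n (λ x → Graph.π A x * Graph.Zv A Ze x y) ≡ Graph.π A y)
      × (∀ (x y : Fin n) → Graph._⊙_ A (Graph.Wv A) (Graph.Zv A Ze) x y ≡ Graph.Wv A x y)
mainTheorem3 n A (A-sym , _) _ deg≥2 _ Ze (M⊗Z≈I , Z⊗M≈I) =
  (λ x → Zv-rowSum A Z-rows x {{deg≢0 x}}) , πᵀZv≡πᵀ , λ _ → πᵀZv≡πᵀ
  where
  deg≢0 : ∀ x → NonZero (Graph.deg A x)
  deg≢0 x = ℕ.>-nonZero (ℕₚ.≤-trans (ℕ.s≤s ℕ.z≤n) (deg≥2 x))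
  M-rows : UnitRowSums A (Graph.Mnb A)
  M-rows = Mnb-unitRowSums A A-sym deg≥2
  Z-rows : UnitRowSums A Ze
  Z-rows = ⊗≈IE⇒unitRowSums A Z⊗M≈I M-rows
  Z-cols : UnitColSums A Ze
  Z-cols = ⊗≈IE⇒unitColSums A M⊗Z≈I (reversible⇒unitColSums A A-sym (Mnb-reversible A) M-rows)
  πᵀZv≡πᵀ : ∀ y → Σℚ n (λ x → Graph.π A x * Graph.Zv A Ze x y) ≡ Graph.π A y
  πᵀZv≡πᵀ = π-Zv-colSum A Z-cols deg≢0
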